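{- Let $M$ be a matroid and $t\in\mathbb{N}$. For $A\subseteq E(M)$ and $e\in A$, the following are equivalent: (1) $e$ is a coloop of $M|A$; (2) every element of $S_e$ is a coloop of $M^t|S_A$; (3) some element of $S_e$ is a coloop of $M^t|S_A$. Moreover, a set $X\subseteq E(M)$ is cyclic in $M$ if and only if $S_X$ is cyclic in $M^t$, and a set $F\subseteq E(M)$ is a flat of $M$ if and only if $S_F$ is a flat of $M^t$.
   Context: A subset of a matroid's ground set is cyclic if it is a (possibly empty) union of circuits, equivalently the restriction to it has no coloops. A cyclic flat of $M$ is a flat that is cyclic; $\mathcal{Z}(M)$ denotes the set of cyclic flats, and a matroid is determined by its cyclic flats and their ranks. The $t$-expansion: for each $e\in E(M)$ let $S_e$ be a $t$-element set with $e\in S_e$, the sets $S_e$ pairwise disjoint; for $X\subseteq E(M)$ let $S_X=\bigcup_{e\in X}S_e$. The $t$-expansion $M^t$ is the matroid on $S_{E(M)}$ whose cyclic flats are exactly the sets $S_A$ with $A\in\mathcal{Z}(M)$, with $r_{M^t}(S_A)=t\cdot r_M(A)$. -}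

module Defs where

open import Data.Nat using (ℕ; _≤_; _<_; _+_; _*_)
open import Data.Fin using (Fin; combine; remQuot)
open import Data.Fin.Subset using (Subset; _∈_; _∉_; _⊆_; _∪_; _∩_; _-_; ⁅_⁆; ∣_∣)
open import Data.Vec using (tabulate; lookup)
open import Data.Product using (Σ; _×_; proj₁)
open import Relation.Nullary using (¬_)
open import Relation.Binary.PropositionalEquality using (_≡_)
open import Function.Bundles using (_⇔_)

record Matroid (n : ℕ) : Set where
  field
    r      : Subset n → ℕ
    r-card : ∀ X → r X ≤ ∣ X ∣
    r-mono : ∀ {X Y} → X ⊆ Y → r X ≤ r Y
    r-sub  : ∀ X Y → r (X ∪ Y) + r (X ∩ Y) ≤ r X + r Y

open Matroid public

-- e is a coloop of the restriction M|A : e ∈ A and deleting e from the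
-- ground set A of M|A lowers its rank (rank of M|A is r_M on subsets of A).
IsColoopOfRestriction : ∀ {n} → Matroid n → Subset n → Fin n → Set
IsColoopOfRestriction M A e = e ∈ A × r M (A - e) < r M A

Cyclic : ∀ {n} → Matroid n → Subset n → Set
Cyclic M X = ∀ e → e ∈ X → ¬ IsColoopOfRestriction M X e

Flat : ∀ {n} → Matroid n → Subset n → Set
Flat M F = ∀ e → e ∉ F → r M F < r M (F ∪ ⁅ e ⁆)

CyclicFlat : ∀ {n} → Matroid n → Subset n → Set
CyclicFlat M Z = Cyclic M Z × Flat M Z

-- Ground set of M^t is Fin (n * t); S_e = { combine e i | i : Fin t }.
-- S X = ⋃_{e ∈ X} S_e.
S : ∀ {n} t → Subset n → Subset (n * t)
S {n} t X = tabulate (λ k → lookup X (proj₁ (remQuot {n} t k)))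

IsExpansion : ∀ {n} t → Matroid n → Matroid (n * t) → Set
IsExpansion t M N =
  (∀ Z → CyclicFlat N Z ⇔ Σ _ (λ A → CyclicFlat M A × Z ≡ S t A)) ×
  (∀ A → CyclicFlat M A → r N (S t A) ≡ t * r M A)

-- In every matroid N, r(Y) = min { r(Z) + |Y − Z| : Z a cyclic flat }. Call the
-- minimising Z attaining for Y. Then x ∈ Y is a coloop of N|Y iff some attaining Z
-- avoids x, and x ∉ Y lies in the closure of Y iff some attaining Z contains x.
-- For the t-expansion the cyclic flats are the S_B, and the quantity minimised for
-- S_X at S_B is exactly t times the quantity for X at B. So S_B attains for S_X iff
-- B attains for X, and the coloop, cyclicity and flatness conditions transfer.
module Submission where

open import Defs
open import Data.Nat using (ℕ; zero; suc; _≤_; _<_; _+_; _*_; NonZero; s≤s; _≤?_; _<?_)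
open import Data.Nat.Properties
open import Data.Nat.Induction using (<-wellFounded)
open import Data.Bool using (Bool; true; false)
open import Data.Fin using (Fin; zero; suc; combine; quotient; _↑ˡ_; _↑ʳ_)
open import Data.Fin.Properties using (any?; splitAt-↑ˡ; splitAt-↑ʳ; remQuot-combine)
open import Data.Fin.Subset using (Subset; _∈_; _∉_; _⊆_; _⊂_; _⊃_; _∪_; _∩_; _─_; _-_; ⁅_⁆; ∣_∣; ⊥)
open import Data.Fin.Subset.Properties
  using (_∈?_; ⊆-refl; ⊆-trans; p⊆q⇒∣p∣≤∣q∣; ∣⊥∣≡0; p⊆p∪q; x∈p∪q⁺; x∈⁅x⁆;
         x∈p∧x∉q⇒x∈p─q; p─q⊆p; p─⊥≡p; ∪-identityʳ)
open import Data.Fin.Subset.Induction using (⊃-wellFounded)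
open import Data.Vec using ([]; _∷_; tabulate; lookup; zipWith)
open import Data.Vec.Base using (here; there)
open import Data.Vec.Properties
  using (lookup∘tabulate; tabulate∘lookup; tabulate-cong; lookup-zipWith; []=⇒lookup; lookup⇒[]=)
open import Data.Product using (_×_; _,_; proj₁; proj₂; ∃)
open import Data.Sum using (inj₁; inj₂)
open import Function using (_∘_; _on_)
open import Function.Bundles using (Equivalence; _⇔_; mk⇔)
open import Induction.WellFounded using (Acc; acc)
import Relation.Binary.Construct.On as On
open import Relation.Nullary using (¬_; yes; no; ¬?; contradiction)
open import Relation.Nullary.Decidable using (_×-dec_)
open import Relation.Binary.PropositionalEquality

open Equivalence using (to; from)

x∈p─q⇒x∉q : ∀ {n} {x : Fin n} (p q : Subset n) → x ∈ p ─ q → x ∉ q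
x∈p─q⇒x∉q (true ∷ p) (false ∷ q) here ()
x∈p─q⇒x∉q (_ ∷ p) (_ ∷ q) (there x∈) (there x∈q) = x∈p─q⇒x∉q p q x∈ x∈q

x∉p⇒p⊂p∪⁅x⁆ : ∀ {n} {p : Subset n} {x} → x ∉ p → p ⊂ p ∪ ⁅ x ⁆
x∉p⇒p⊂p∪⁅x⁆ {x = x} x∉p = p⊆p∪q ⁅ x ⁆ , x , x∈p∪q⁺ (inj₂ (x∈⁅x⁆ x)) , x∉p

p⊆q⇒∣p─r∣≤∣q─r∣ : ∀ {n} {p q : Subset n} (r : Subset n) → p ⊆ q → ∣ p ─ r ∣ ≤ ∣ q ─ r ∣
p⊆q⇒∣p─r∣≤∣q─r∣ {p = p} r p⊆q =
  p⊆q⇒∣p∣≤∣q∣ (λ x∈ → x∈p∧x∉q⇒x∈p─q (p⊆q (p─q⊆p p r x∈)) (x∈p─q⇒x∉q p r x∈))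

p⊆q⇒∣p─q∣≡0 : ∀ {n} {p q : Subset n} → p ⊆ q → ∣ p ─ q ∣ ≡ 0
p⊆q⇒∣p─q∣≡0 {n} {p} {q} p⊆q = n≤0⇒n≡0 (≤-trans (p⊆q⇒∣p∣≤∣q∣ p─q⊆⊥) (≤-reflexive (∣⊥∣≡0 n)))
  where
  p─q⊆⊥ : p ─ q ⊆ ⊥
  p─q⊆⊥ x∈ = contradiction (p⊆q (p─q⊆p p q x∈)) (x∈p─q⇒x∉q p q x∈)

x∈q⇒∣p-x─q∣≡∣p─q∣ : ∀ {n} (p q : Subset n) x → x ∈ q → ∣ p - x ─ q ∣ ≡ ∣ p ─ q ∣
x∈q⇒∣p-x─q∣≡∣p─q∣ (_ ∷ p) (true ∷ q) zero here = cong (λ p′ → ∣ p′ ─ q ∣) (p─⊥≡p p)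
x∈q⇒∣p-x─q∣≡∣p─q∣ (_ ∷ p) (true ∷ q) (suc x) (there x∈q) =
  x∈q⇒∣p-x─q∣≡∣p─q∣ p q x x∈q
x∈q⇒∣p-x─q∣≡∣p─q∣ (true ∷ p) (false ∷ q) (suc x) (there x∈q) =
  cong suc (x∈q⇒∣p-x─q∣≡∣p─q∣ p q x x∈q)
x∈q⇒∣p-x─q∣≡∣p─q∣ (false ∷ p) (false ∷ q) (suc x) (there x∈q) =
  x∈q⇒∣p-x─q∣≡∣p─q∣ p q x x∈q

x∈p∧x∉q⇒∣p─q∣≡1+∣p-x─q∣ : ∀ {n} (p q : Subset n) x → x ∈ p → x ∉ q →
  ∣ p ─ q ∣ ≡ suc ∣ p - x ─ q ∣
x∈p∧x∉q⇒∣p─q∣≡1+∣p-x─q∣ (true ∷ p) (true ∷ q) zero here x∉q = contradiction here x∉q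
x∈p∧x∉q⇒∣p─q∣≡1+∣p-x─q∣ (true ∷ p) (false ∷ q) zero here x∉q =
  cong (λ p′ → suc ∣ p′ ─ q ∣) (sym (p─⊥≡p p))
x∈p∧x∉q⇒∣p─q∣≡1+∣p-x─q∣ (_ ∷ p) (true ∷ q) (suc x) (there x∈p) x∉q =
  x∈p∧x∉q⇒∣p─q∣≡1+∣p-x─q∣ p q x x∈p (x∉q ∘ there)
x∈p∧x∉q⇒∣p─q∣≡1+∣p-x─q∣ (true ∷ p) (false ∷ q) (suc x) (there x∈p) x∉q =
  cong suc (x∈p∧x∉q⇒∣p─q∣≡1+∣p-x─q∣ p q x x∈p (x∉q ∘ there))
x∈p∧x∉q⇒∣p─q∣≡1+∣p-x─q∣ (false ∷ p) (false ∷ q) (suc x) (there x∈p) x∉q =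
  x∈p∧x∉q⇒∣p─q∣≡1+∣p-x─q∣ p q x x∈p (x∉q ∘ there)

∣p─q∣≤1+∣p-x─q∣ : ∀ {n} (p q : Subset n) x → x ∈ p → ∣ p ─ q ∣ ≤ suc ∣ p - x ─ q ∣
∣p─q∣≤1+∣p-x─q∣ p q x x∈p with x ∈? q
... | yes x∈q = ≤-trans (≤-reflexive (sym (x∈q⇒∣p-x─q∣≡∣p─q∣ p q x x∈q))) (n≤1+n _)
... | no x∉q = ≤-reflexive (x∈p∧x∉q⇒∣p─q∣≡1+∣p-x─q∣ p q x x∈p x∉q)

x∈q⇒∣p∪⁅x⁆─q∣≡∣p─q∣ : ∀ {n} (p q : Subset n) x → x ∈ q → ∣ p ∪ ⁅ x ⁆ ─ q ∣ ≡ ∣ p ─ q ∣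
x∈q⇒∣p∪⁅x⁆─q∣≡∣p─q∣ (_ ∷ p) (true ∷ q) zero here = cong (λ p′ → ∣ p′ ─ q ∣) (∪-identityʳ p)
x∈q⇒∣p∪⁅x⁆─q∣≡∣p─q∣ (_ ∷ p) (true ∷ q) (suc x) (there x∈q) =
  x∈q⇒∣p∪⁅x⁆─q∣≡∣p─q∣ p q x x∈q
x∈q⇒∣p∪⁅x⁆─q∣≡∣p─q∣ (true ∷ p) (false ∷ q) (suc x) (there x∈q) =
  cong suc (x∈q⇒∣p∪⁅x⁆─q∣≡∣p─q∣ p q x x∈q)
x∈q⇒∣p∪⁅x⁆─q∣≡∣p─q∣ (false ∷ p) (false ∷ q) (suc x) (there x∈q) =
  x∈q⇒∣p∪⁅x⁆─q∣≡∣p─q∣ p q x x∈q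

x∉p∧x∉q⇒∣p∪⁅x⁆─q∣≡1+∣p─q∣ : ∀ {n} (p q : Subset n) x → x ∉ p → x ∉ q →
  ∣ p ∪ ⁅ x ⁆ ─ q ∣ ≡ suc ∣ p ─ q ∣
x∉p∧x∉q⇒∣p∪⁅x⁆─q∣≡1+∣p─q∣ (_ ∷ p) (true ∷ q) zero x∉p x∉q = contradiction here x∉q
x∉p∧x∉q⇒∣p∪⁅x⁆─q∣≡1+∣p─q∣ (true ∷ p) (false ∷ q) zero x∉p x∉q = contradiction here x∉p
x∉p∧x∉q⇒∣p∪⁅x⁆─q∣≡1+∣p─q∣ (false ∷ p) (false ∷ q) zero x∉p x∉q =
  cong (λ p′ → suc ∣ p′ ─ q ∣) (∪-identityʳ p)
x∉p∧x∉q⇒∣p∪⁅x⁆─q∣≡1+∣p─q∣ (_ ∷ p) (true ∷ q) (suc x) x∉p x∉q =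
  x∉p∧x∉q⇒∣p∪⁅x⁆─q∣≡1+∣p─q∣ p q x (x∉p ∘ there) (x∉q ∘ there)
x∉p∧x∉q⇒∣p∪⁅x⁆─q∣≡1+∣p─q∣ (true ∷ p) (false ∷ q) (suc x) x∉p x∉q =
  cong suc (x∉p∧x∉q⇒∣p∪⁅x⁆─q∣≡1+∣p─q∣ p q x (x∉p ∘ there) (x∉q ∘ there))
x∉p∧x∉q⇒∣p∪⁅x⁆─q∣≡1+∣p─q∣ (false ∷ p) (false ∷ q) (suc x) x∉p x∉q =
  x∉p∧x∉q⇒∣p∪⁅x⁆─q∣≡1+∣p─q∣ p q x (x∉p ∘ there) (x∉q ∘ there)

-- With r≤r+∣─∣ below, the inequality is an equality.
Attains : ∀ {n} → Matroid n → Subset n → Subset n → Set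
Attains N X Z = CyclicFlat N Z × r N Z + ∣ X ─ Z ∣ ≤ r N X

module _ {n} (N : Matroid n) where

  r≤r+∣─∣ : ∀ X Z → r N X ≤ r N Z + ∣ X ─ Z ∣
  r≤r+∣─∣ X Z = begin
      r N X                                  ≤⟨ r-mono N X⊆Z∪[X─Z] ⟩
      r N (Z ∪ (X ─ Z))                      ≤⟨ m≤m+n _ _ ⟩
      r N (Z ∪ (X ─ Z)) + r N (Z ∩ (X ─ Z))  ≤⟨ r-sub N Z (X ─ Z) ⟩
      r N Z + r N (X ─ Z)                    ≤⟨ +-monoʳ-≤ (r N Z) (r-card N (X ─ Z)) ⟩
      r N Z + ∣ X ─ Z ∣                      ∎
    where
    open ≤-Reasoning
    X⊆Z∪[X─Z] : X ⊆ Z ∪ (X ─ Z)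
    X⊆Z∪[X─Z] {x} x∈X with x ∈? Z
    ... | yes x∈Z = x∈p∪q⁺ (inj₁ x∈Z)
    ... | no x∉Z = x∈p∪q⁺ (inj₂ (x∈p∧x∉q⇒x∈p─q x∈X x∉Z))

  flat-superset : ∀ X → ∃ λ F → Flat N F × X ⊆ F × r N F ≤ r N X
  flat-superset X = go X (⊃-wellFounded X)
    where
    go : ∀ X → Acc _⊃_ X → ∃ λ F → Flat N F × X ⊆ F × r N F ≤ r N X
    go X (acc rec) with any? (λ e → ¬? (e ∈? X) ×-dec (r N (X ∪ ⁅ e ⁆) ≤? r N X))
    ... | no noSpanned = X , flat , ⊆-refl , ≤-refl
      where
      flat : Flat N X
      flat e e∉X = ≰⇒> (λ le → noSpanned (e , e∉X , le))
    ... | yes (e , e∉X , le) with go (X ∪ ⁅ e ⁆) (rec (x∉p⇒p⊂p∪⁅x⁆ e∉X))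
    ...   | F , flatF , X∪e⊆F , rF≤ = F , flatF , ⊆-trans (p⊆p∪q ⁅ e ⁆) X∪e⊆F , ≤-trans rF≤ le

  -- A flat F ⊇ X of the same rank is either cyclic, and attains the rank of X, or
  -- loses a coloop e; then F - e has smaller rank and whatever attains its rank
  -- also attains the rank of X.
  attaining : ∀ X → ∃ (Attains N X)
  attaining X = go X (On.wellFounded (r N) <-wellFounded X)
    where
    open ≤-Reasoning
    go : ∀ X → Acc (_<_ on r N) X → ∃ (Attains N X)
    go X (acc rec) with flat-superset X
    ... | F , flatF , X⊆F , rF≤rX with any? (λ e → (e ∈? F) ×-dec (r N (F - e) <? r N F))
    ...   | no noColoop = F , (cyclic , flatF) , (begin
            r N F + ∣ X ─ F ∣ ≡⟨ cong (r N F +_) (p⊆q⇒∣p─q∣≡0 X⊆F) ⟩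
            r N F + 0         ≡⟨ +-identityʳ (r N F) ⟩
            r N F             ≤⟨ rF≤rX ⟩
            r N X             ∎)
      where
      cyclic : Cyclic N F
      cyclic e e∈F (_ , lt) = noColoop (e , e∈F , lt)
    ...   | yes (e , e∈F , lt) with go (F - e) (rec (<-≤-trans lt rF≤rX))
    ...     | Z , cfZ , tight = Z , cfZ , (begin
            r N Z + ∣ X ─ Z ∣             ≤⟨ +-monoʳ-≤ (r N Z) (p⊆q⇒∣p─r∣≤∣q─r∣ Z X⊆F) ⟩
            r N Z + ∣ F ─ Z ∣             ≤⟨ +-monoʳ-≤ (r N Z) (∣p─q∣≤1+∣p-x─q∣ F Z e e∈F) ⟩
            r N Z + suc ∣ F - e ─ Z ∣     ≡⟨ +-suc (r N Z) _ ⟩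
            suc (r N Z + ∣ F - e ─ Z ∣)   ≤⟨ s≤s tight ⟩
            suc (r N (F - e))             ≤⟨ lt ⟩
            r N F                         ≤⟨ rF≤rX ⟩
            r N X                         ∎)

  coloop⇔∃attaining∌ : ∀ {Y x} → x ∈ Y → r N (Y - x) < r N Y ⇔ ∃ λ Z → Attains N Y Z × x ∉ Z
  coloop⇔∃attaining∌ {Y} {x} x∈Y = mk⇔ coloop⇒ ⇒coloop
    where
    open ≤-Reasoning
    coloop⇒ : r N (Y - x) < r N Y → ∃ λ Z → Attains N Y Z × x ∉ Z
    coloop⇒ lt with attaining (Y - x)
    ... | Z , cfZ , tight with x ∈? Z
    ...   | yes x∈Z = contradiction lt (≤⇒≯ (begin
            r N Y                   ≤⟨ r≤r+∣─∣ Y Z ⟩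
            r N Z + ∣ Y ─ Z ∣       ≡⟨ cong (r N Z +_) (x∈q⇒∣p-x─q∣≡∣p─q∣ Y Z x x∈Z) ⟨
            r N Z + ∣ Y - x ─ Z ∣   ≤⟨ tight ⟩
            r N (Y - x)             ∎))
    ...   | no x∉Z = Z , (cfZ , (begin
            r N Z + ∣ Y ─ Z ∣             ≡⟨ cong (r N Z +_) (x∈p∧x∉q⇒∣p─q∣≡1+∣p-x─q∣ Y Z x x∈Y x∉Z) ⟩
            r N Z + suc ∣ Y - x ─ Z ∣     ≡⟨ +-suc (r N Z) _ ⟩
            suc (r N Z + ∣ Y - x ─ Z ∣)   ≤⟨ s≤s tight ⟩
            suc (r N (Y - x))             ≤⟨ lt ⟩
            r N Y                         ∎)) , x∉Z
    ⇒coloop : (∃ λ Z → Attains N Y Z × x ∉ Z) → r N (Y - x) < r N Y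
    ⇒coloop (Z , (_ , tight) , x∉Z) = begin-strict
      r N (Y - x)                 ≤⟨ r≤r+∣─∣ (Y - x) Z ⟩
      r N Z + ∣ Y - x ─ Z ∣       <⟨ +-monoʳ-< (r N Z) (n<1+n _) ⟩
      r N Z + suc ∣ Y - x ─ Z ∣   ≡⟨ cong (r N Z +_) (x∈p∧x∉q⇒∣p─q∣≡1+∣p-x─q∣ Y Z x x∈Y x∉Z) ⟨
      r N Z + ∣ Y ─ Z ∣           ≤⟨ tight ⟩
      r N Y                       ∎

  spanned⇔∃attaining∋ : ∀ {Y x} → x ∉ Y → r N (Y ∪ ⁅ x ⁆) ≤ r N Y ⇔ ∃ λ Z → Attains N Y Z × x ∈ Z
  spanned⇔∃attaining∋ {Y} {x} x∉Y = mk⇔ spanned⇒ ⇒spanned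
    where
    open ≤-Reasoning
    spanned⇒ : r N (Y ∪ ⁅ x ⁆) ≤ r N Y → ∃ λ Z → Attains N Y Z × x ∈ Z
    spanned⇒ le with attaining (Y ∪ ⁅ x ⁆)
    ... | Z , cfZ , tight with x ∈? Z
    ...   | yes x∈Z = Z , (cfZ , (begin
            r N Z + ∣ Y ─ Z ∣           ≡⟨ cong (r N Z +_) (x∈q⇒∣p∪⁅x⁆─q∣≡∣p─q∣ Y Z x x∈Z) ⟨
            r N Z + ∣ Y ∪ ⁅ x ⁆ ─ Z ∣   ≤⟨ tight ⟩
            r N (Y ∪ ⁅ x ⁆)             ≤⟨ le ⟩
            r N Y                       ∎)) , x∈Z
    ...   | no x∉Z = contradiction (r≤r+∣─∣ Y Z) (<⇒≱ (begin-strict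
            r N Z + ∣ Y ─ Z ∣           <⟨ +-monoʳ-< (r N Z) (n<1+n _) ⟩
            r N Z + suc ∣ Y ─ Z ∣       ≡⟨ cong (r N Z +_) (x∉p∧x∉q⇒∣p∪⁅x⁆─q∣≡1+∣p─q∣ Y Z x x∉Y x∉Z) ⟨
            r N Z + ∣ Y ∪ ⁅ x ⁆ ─ Z ∣   ≤⟨ tight ⟩
            r N (Y ∪ ⁅ x ⁆)             ≤⟨ le ⟩
            r N Y                       ∎))
    ⇒spanned : (∃ λ Z → Attains N Y Z × x ∈ Z) → r N (Y ∪ ⁅ x ⁆) ≤ r N Y
    ⇒spanned (Z , (_ , tight) , x∈Z) = begin
      r N (Y ∪ ⁅ x ⁆)             ≤⟨ r≤r+∣─∣ (Y ∪ ⁅ x ⁆) Z ⟩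
      r N Z + ∣ Y ∪ ⁅ x ⁆ ─ Z ∣   ≡⟨ cong (r N Z +_) (x∈q⇒∣p∪⁅x⁆─q∣≡∣p─q∣ Y Z x x∈Z) ⟩
      r N Z + ∣ Y ─ Z ∣           ≤⟨ tight ⟩
      r N Y                       ∎

  flat⇔∄attaining∋ : ∀ F → Flat N F ⇔ (∀ x → x ∉ F → ¬ ∃ λ Z → Attains N F Z × x ∈ Z)
  flat⇔∄attaining∋ F = mk⇔
    (λ flat x x∉F attained → <⇒≱ (flat x x∉F) (from (spanned⇔∃attaining∋ x∉F) attained))
    (λ unattained x x∉F → ≰⇒> (unattained x x∉F ∘ to (spanned⇔∃attaining∋ x∉F)))

∣tabulate∣-split : ∀ m k (f : Fin (m + k) → Bool) →
  ∣ tabulate f ∣ ≡ ∣ tabulate (f ∘ (_↑ˡ k)) ∣ + ∣ tabulate (f ∘ (m ↑ʳ_)) ∣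
∣tabulate∣-split zero    k f = refl
∣tabulate∣-split (suc m) k f with f zero | ∣tabulate∣-split m k (f ∘ suc)
... | true  | eq = cong suc eq
... | false | eq = eq

∣tabulate-const∣ : ∀ m (b : Bool) → ∣ tabulate {n = m} (λ _ → b) ∣ ≡ m * ∣ b ∷ [] ∣
∣tabulate-const∣ zero    b     = refl
∣tabulate-const∣ (suc m) true  = cong suc (∣tabulate-const∣ m true)
∣tabulate-const∣ (suc m) false = ∣tabulate-const∣ m false

module _ (t : ℕ) where

  lookup-S : ∀ {n} (X : Subset n) y → lookup (S t X) y ≡ lookup X (quotient t y)
  lookup-S X y = lookup∘tabulate _ y

  ∈S⇔ : ∀ {n} {X : Subset n} {y} → y ∈ S t X ⇔ quotient t y ∈ X
  ∈S⇔ {X = X} {y} = mk⇔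
    (λ y∈ → lookup⇒[]= _ X (trans (sym (lookup-S X y)) ([]=⇒lookup y∈)))
    (λ q∈ → lookup⇒[]= y (S t X) (trans (lookup-S X y) ([]=⇒lookup q∈)))

  quotient-combine : ∀ {n} (e : Fin n) i → quotient t (combine e i) ≡ e
  quotient-combine e i = cong proj₁ (remQuot-combine e i)

  S-zipWith : ∀ {n} (g : Bool → Bool → Bool) (X Z : Subset n) →
    S t (zipWith g X Z) ≡ zipWith g (S t X) (S t Z)
  S-zipWith g X Z = trans (tabulate-cong pointwise) (tabulate∘lookup (zipWith g (S t X) (S t Z)))
    where
    pointwise : ∀ y → lookup (zipWith g X Z) (quotient t y) ≡ lookup (zipWith g (S t X) (S t Z)) y
    pointwise y = begin
      lookup (zipWith g X Z) (quotient t y)                  ≡⟨ lookup-zipWith g (quotient t y) X Z ⟩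
      g (lookup X (quotient t y)) (lookup Z (quotient t y))  ≡⟨ cong₂ g (lookup-S X y) (lookup-S Z y) ⟨
      g (lookup (S t X) y) (lookup (S t Z) y)                ≡⟨ lookup-zipWith g y (S t X) (S t Z) ⟨
      lookup (zipWith g (S t X) (S t Z)) y                   ∎
      where open ≡-Reasoning

  ∣S∣ : ∀ {n} (X : Subset n) → ∣ S t X ∣ ≡ t * ∣ X ∣
  ∣S∣ [] = sym (*-zeroʳ t)
  ∣S∣ {suc n} (b ∷ X) = begin
    ∣ S t (b ∷ X) ∣                            ≡⟨ ∣tabulate∣-split t (n * t) _ ⟩
    ∣ tabulate first ∣ + ∣ tabulate rest ∣
      ≡⟨ cong₂ (λ u v → ∣ u ∣ + ∣ v ∣) (tabulate-cong first-block) (tabulate-cong later-blocks) ⟩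
    ∣ tabulate {n = t} (λ _ → b) ∣ + ∣ S t X ∣ ≡⟨ cong₂ _+_ (∣tabulate-const∣ t b) (∣S∣ X) ⟩
    t * ∣ b ∷ [] ∣ + t * ∣ X ∣                  ≡⟨ *-distribˡ-+ t ∣ b ∷ [] ∣ ∣ X ∣ ⟨
    t * (∣ b ∷ [] ∣ + ∣ X ∣)                    ≡⟨ cong (t *_) (∣b∷[]∣+∣X∣ b) ⟩
    t * ∣ b ∷ X ∣                               ∎
    where
    open ≡-Reasoning
    first : Fin t → Bool
    first i = lookup (b ∷ X) (quotient t (i ↑ˡ n * t))
    rest : Fin (n * t) → Bool
    rest j = lookup (b ∷ X) (quotient t (t ↑ʳ j))
    first-block : ∀ i → first i ≡ b
    first-block i rewrite splitAt-↑ˡ t i (n * t) = refl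
    later-blocks : ∀ j → rest j ≡ lookup X (quotient t j)
    later-blocks j rewrite splitAt-↑ʳ t (n * t) j = refl
    ∣b∷[]∣+∣X∣ : ∀ b → ∣ b ∷ [] ∣ + ∣ X ∣ ≡ ∣ b ∷ X ∣
    ∣b∷[]∣+∣X∣ true  = refl
    ∣b∷[]∣+∣X∣ false = refl

  ∀⇔∀-quotient : ∀ {n} → Fin t → {P : Fin n → Set} → (∀ e → P e) ⇔ (∀ y → P (quotient t y))
  ∀⇔∀-quotient i₀ {P} = mk⇔
    (λ ∀P y → ∀P (quotient t y))
    (λ ∀P e → subst P (quotient-combine e i₀) (∀P (combine e i₀)))

  ∣S─S∣ : ∀ {n} (X Z : Subset n) → ∣ S t X ─ S t Z ∣ ≡ t * ∣ X ─ Z ∣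
  ∣S─S∣ X Z = trans (cong ∣_∣ (sym (S-zipWith _ X Z))) (∣S∣ (X ─ Z))

module Expansion {n} (t : ℕ) (M : Matroid n) (Mt : Matroid (n * t))
                 (expansion : IsExpansion t M Mt) where

  cyclicFlat⇔S : ∀ Z → CyclicFlat Mt Z ⇔ ∃ λ B → CyclicFlat M B × Z ≡ S t B
  cyclicFlat⇔S = proj₁ expansion

  bound-S : ∀ X {B} → CyclicFlat M B → r Mt (S t B) + ∣ S t X ─ S t B ∣ ≡ t * (r M B + ∣ X ─ B ∣)
  bound-S X {B} cfB = begin
    r Mt (S t B) + ∣ S t X ─ S t B ∣ ≡⟨ cong₂ _+_ (proj₂ expansion B cfB) (∣S─S∣ t X B) ⟩
    t * r M B + t * ∣ X ─ B ∣         ≡⟨ *-distribˡ-+ t (r M B) ∣ X ─ B ∣ ⟨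
    t * (r M B + ∣ X ─ B ∣)           ∎
    where open ≡-Reasoning

  r-S : ∀ X → r Mt (S t X) ≡ t * r M X
  r-S X = ≤-antisym upper lower
    where
    open ≤-Reasoning
    upper : r Mt (S t X) ≤ t * r M X
    upper with attaining M X
    ... | B , cfB , tight = begin
      r Mt (S t X)                      ≤⟨ r≤r+∣─∣ Mt (S t X) (S t B) ⟩
      r Mt (S t B) + ∣ S t X ─ S t B ∣  ≡⟨ bound-S X cfB ⟩
      t * (r M B + ∣ X ─ B ∣)           ≤⟨ *-monoʳ-≤ t tight ⟩
      t * r M X                         ∎
    lower : t * r M X ≤ r Mt (S t X)
    lower with attaining Mt (S t X)
    ... | Z , cfZ , tight with to (cyclicFlat⇔S Z) cfZ
    ...   | B , cfB , refl = begin
      t * r M X                         ≤⟨ *-monoʳ-≤ t (r≤r+∣─∣ M X B) ⟩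
      t * (r M B + ∣ X ─ B ∣)           ≡⟨ bound-S X cfB ⟨
      r Mt (S t B) + ∣ S t X ─ S t B ∣  ≤⟨ tight ⟩
      r Mt (S t X)                      ∎

  tight-S⇔ : .{{_ : NonZero t}} → ∀ X {B} → CyclicFlat M B →
    r Mt (S t B) + ∣ S t X ─ S t B ∣ ≤ r Mt (S t X) ⇔ r M B + ∣ X ─ B ∣ ≤ r M X
  tight-S⇔ X cfB = mk⇔
    (λ le → *-cancelˡ-≤ t (subst₂ _≤_ (bound-S X cfB) (r-S X) le))
    (λ le → subst₂ _≤_ (sym (bound-S X cfB)) (sym (r-S X)) (*-monoʳ-≤ t le))

  ∃attaining-S⇔ : .{{_ : NonZero t}} → ∀ X (P : Subset (n * t) → Set) (Q : Subset n → Set) →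
    (∀ B → P (S t B) ⇔ Q B) → (∃ λ Z → Attains Mt (S t X) Z × P Z) ⇔ (∃ λ B → Attains M X B × Q B)
  ∃attaining-S⇔ X P Q P⇔Q = mk⇔ S⇒ ⇒S
    where
    S⇒ : (∃ λ Z → Attains Mt (S t X) Z × P Z) → ∃ λ B → Attains M X B × Q B
    S⇒ (Z , (cfZ , tight) , pZ) with to (cyclicFlat⇔S Z) cfZ
    ... | B , cfB , refl = B , (cfB , to (tight-S⇔ X cfB) tight) , to (P⇔Q B) pZ
    ⇒S : (∃ λ B → Attains M X B × Q B) → ∃ λ Z → Attains Mt (S t X) Z × P Z
    ⇒S (B , (cfB , tight) , qB) =
      S t B , (from (cyclicFlat⇔S (S t B)) (B , cfB , refl) , from (tight-S⇔ X cfB) tight) ,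
      from (P⇔Q B) qB

  coloop-S⇔ : .{{_ : NonZero t}} → ∀ A y →
    IsColoopOfRestriction M A (quotient t y) ⇔ IsColoopOfRestriction Mt (S t A) y
  coloop-S⇔ A y = mk⇔
    (λ (e∈A , lt) → let y∈ = from (∈S⇔ t) e∈A in
      y∈ , from (coloop⇔∃attaining∌ Mt y∈) (from avoided⇔ (to (coloop⇔∃attaining∌ M e∈A) lt)))
    (λ (y∈ , lt) → let e∈A = to (∈S⇔ t) y∈ in
      e∈A , from (coloop⇔∃attaining∌ M e∈A) (to avoided⇔ (to (coloop⇔∃attaining∌ Mt y∈) lt)))
    where
    avoided⇔ : (∃ λ Z → Attains Mt (S t A) Z × y ∉ Z) ⇔ (∃ λ B → Attains M A B × quotient t y ∉ B)
    avoided⇔ = ∃attaining-S⇔ A (y ∉_) (quotient t y ∉_)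
      (λ B → mk⇔ (λ y∉ q∈ → y∉ (from (∈S⇔ t) q∈)) (λ q∉ y∈ → q∉ (to (∈S⇔ t) y∈)))

  coloop-combine⇔ : .{{_ : NonZero t}} → ∀ A e i →
    IsColoopOfRestriction M A e ⇔ IsColoopOfRestriction Mt (S t A) (combine e i)
  coloop-combine⇔ A e i =
    subst (λ x → IsColoopOfRestriction M A x ⇔ IsColoopOfRestriction Mt (S t A) (combine e i))
          (quotient-combine t e i) (coloop-S⇔ A (combine e i))

  cyclic-S⇔ : .{{_ : NonZero t}} → Fin t → ∀ X → Cyclic M X ⇔ Cyclic Mt (S t X)
  cyclic-S⇔ i₀ X = mk⇔
    (λ cyclic y y∈ → to (∀⇔∀-quotient t i₀) cyclic y (to (∈S⇔ t) y∈) ∘ from (coloop-S⇔ X y))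
    (λ cyclic → from (∀⇔∀-quotient t i₀) λ y q∈ → cyclic y (from (∈S⇔ t) q∈) ∘ to (coloop-S⇔ X y))

  flat-S⇔ : .{{_ : NonZero t}} → Fin t → ∀ F → Flat M F ⇔ Flat Mt (S t F)
  flat-S⇔ i₀ F = mk⇔
    (λ flat → from (flat⇔∄attaining∋ Mt (S t F)) λ y y∉ attained →
      to (∀⇔∀-quotient t i₀) (to (flat⇔∄attaining∋ M F) flat) y
         (y∉ ∘ from (∈S⇔ t)) (to (attained⇔ y) attained))
    (λ flat → from (flat⇔∄attaining∋ M F) (from (∀⇔∀-quotient t i₀) λ y q∉ attained →
      to (flat⇔∄attaining∋ Mt (S t F)) flat y (q∉ ∘ to (∈S⇔ t)) (from (attained⇔ y) attained)))
    where
    attained⇔ : ∀ y → (∃ λ Z → Attains Mt (S t F) Z × y ∈ Z) ⇔ (∃ λ B → Attains M F B × quotient t y ∈ B)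
    attained⇔ y = ∃attaining-S⇔ F (y ∈_) (quotient t y ∈_) (λ B → ∈S⇔ t)

lemma3p7 : ∀ {n} (t : ℕ) → 1 ≤ t → (M : Matroid n) (Mt : Matroid (n * t)) →
    IsExpansion t M Mt →
    (∀ (A : Subset n) (e : Fin n) → e ∈ A →
      (IsColoopOfRestriction M A e ⇔ (∀ (i : Fin t) → IsColoopOfRestriction Mt (S t A) (combine e i)))
      × (IsColoopOfRestriction M A e ⇔ ∃ (λ (i : Fin t) → IsColoopOfRestriction Mt (S t A) (combine e i))))
    × (∀ (X : Subset n) → Cyclic M X ⇔ Cyclic Mt (S t X))
    × (∀ (F : Subset n) → Flat M F ⇔ Flat Mt (S t F))
lemma3p7 t@(suc _) _ M Mt expansion = coloops , cyclic-S⇔ zero , flat-S⇔ zero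
  where
  open Expansion t M Mt expansion
  coloops : ∀ A e → e ∈ A →
    (IsColoopOfRestriction M A e ⇔ (∀ i → IsColoopOfRestriction Mt (S t A) (combine e i)))
    × (IsColoopOfRestriction M A e ⇔ ∃ λ i → IsColoopOfRestriction Mt (S t A) (combine e i))
  coloops A e _ =
    mk⇔ (λ coloop i → to (coloop-combine⇔ A e i) coloop)
        (λ coloop-everywhere → from (coloop-combine⇔ A e zero) (coloop-everywhere zero)) ,
    mk⇔ (λ coloop → zero , to (coloop-combine⇔ A e zero) coloop)
        (λ (i , coloop) → from (coloop-combine⇔ A e i) coloop)
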